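{- Let $p\geq 2$ and let $G$ be a $2p$-regular graph. The following are equivalent: (I) $G$ admits a $(p+2)$-star colouring; (II) $G$ admits a $(p+2)$-coloured MINI-orientation; (III) $G$ has an orientation that admits an out-neighbourhood bijective homomorphism to $\vec{L}(K_{p+2})$; (IV) $G$ admits a $(p+2)$-colouring $f$ such that every bicoloured component of $(G,f)$ is isomorphic to $K_{1,p}$.
   Context: Graphs are finite and simple. A $k$-colouring of $G$ is a map $f\colon V(G)\to\mathbb{Z}_k$ with $f(u)\neq f(v)$ for every edge $uv$. A bicoloured component of $(G,f)$ is a connected component of the subgraph induced by the union of two colour classes. A $k$-star colouring is a $k$-colouring in which every bicoloured component is a star $K_{1,q}$ ($q\geq 0$). A coloured orientation of $G$ is a pair $(\vec{G},f)$ where $\vec{G}$ is an orientation of $G$ and $f$ is a colouring of $G$. It is a $q$-coloured MINI-orientation if $f$ is a $q$-colouring and for every vertex $v$: (i) no out-neighbour of $v$ has the same colour as an in-neighbour of $v$; (ii) the out-neighbours of $v$ have pairwise distinct colours; (iii) all in-neighbours of $v$ have the same colour. The oriented line graph $\vec{L}(K_q)$ has as vertices the ordered pairs $(i,j)$ of distinct elements of $\mathbb{Z}_q$, with an arc from $(i,j)$ to $(j,k)$ whenever $k\neq i$. An out-neighbourhood bijective homomorphism (OBH) from an oriented graph $\vec{G}$ to an oriented graph $\vec{H}$ is a map $\psi\colon V(\vec{G})\to V(\vec{H})$ such that for every vertex $v$ of $\vec{G}$, the restriction of $\psi$ to the out-neighbourhood $N^+_{\vec{G}}(v)$ is a bijection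 onto $N^+_{\vec{H}}(\psi(v))$. -}

module Defs where

open import Data.Nat using (ℕ; zero; suc; _+_; _*_)
open import Data.Bool using (Bool; true; false; if_then_else_)
open import Data.Fin using (Fin)
open import Data.List using (List; map; allFin)
open import Data.Nat.ListAction using (sum)
open import Data.Product using (Σ; Σ-syntax; ∃; ∃-syntax; _×_; _,_; proj₁; proj₂)
open import Data.Sum using (_⊎_)
open import Relation.Binary.PropositionalEquality using (_≡_; _≢_)

record Graph : Set where
  field
    n       : ℕ
    adj     : Fin n → Fin n → Bool
    adj-sym : ∀ u v → adj u v ≡ adj v u
    adj-irr : ∀ v → adj v v ≡ false

open Graph public

Adj : (G : Graph) → Fin (n G) → Fin (n G) → Set
Adj G u v = adj G u v ≡ true

NonAdj : (G : Graph) → Fin (n G) → Fin (n G) → Set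
NonAdj G u v = adj G u v ≡ false

degree : (G : Graph) → Fin (n G) → ℕ
degree G v = sum (map (λ w → if adj G v w then 1 else 0) (allFin (n G)))

Regular : ℕ → Graph → Set
Regular d G = ∀ v → degree G v ≡ d

IsColouring : (G : Graph) (k : ℕ) → (Fin (n G) → Fin k) → Set
IsColouring G k f = ∀ u v → Adj G u v → f u ≢ f v

-- Reach G f a b v w : w is in the connected component of v in the subgraph
-- induced by the union of the colour classes a and b.
data Reach (G : Graph) {k : ℕ} (f : Fin (n G) → Fin k) (a b : Fin k)
           (v : Fin (n G)) : Fin (n G) → Set where
  here : (f v ≡ a ⊎ f v ≡ b) → Reach G f a b v v
  step : ∀ {u w} → Reach G f a b v u → Adj G u w → (f w ≡ a ⊎ f w ≡ b) →
         Reach G f a b v w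

-- The subgraph of G induced by the vertex set S is isomorphic to K_{1,q}:
-- an explicit isomorphism from K_{1,q} (centre c, leaves ℓ 0 .. ℓ (q-1)),
-- i.e. a bijection onto S preserving adjacency and non-adjacency.
InducedIsoStar : (G : Graph) → (Fin (n G) → Set) → ℕ → Set
InducedIsoStar G S q =
  Σ[ c ∈ Fin (n G) ] Σ[ ℓ ∈ (Fin q → Fin (n G)) ]
    (∀ i j → ℓ i ≡ ℓ j → i ≡ j)
    × (∀ i → c ≢ ℓ i)
    × (∀ w → S w → (w ≡ c ⊎ ∃[ i ] ℓ i ≡ w))
    × S c
    × (∀ i → S (ℓ i))
    × (∀ i → Adj G c (ℓ i))
    × (∀ i j → NonAdj G (ℓ i) (ℓ j))

AllBicolComps : (G : Graph) {k : ℕ} → (Fin (n G) → Fin k) →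
                ((Fin (n G) → Set) → Set) → Set
AllBicolComps G {k} f P =
  ∀ (a b : Fin k) → a ≢ b → ∀ v → (f v ≡ a ⊎ f v ≡ b) → P (Reach G f a b v)

IsStar : (G : Graph) → (Fin (n G) → Set) → Set
IsStar G S = ∃[ q ] InducedIsoStar G S q

IsStarColouring : (G : Graph) (k : ℕ) → (Fin (n G) → Fin k) → Set
IsStarColouring G k f = IsColouring G k f × AllBicolComps G f (IsStar G)

HasStarColouring : Graph → ℕ → Set
HasStarColouring G k = Σ[ f ∈ (Fin (n G) → Fin k) ] IsStarColouring G k f

IsOrientation : (G : Graph) → (Fin (n G) → Fin (n G) → Bool) → Set
IsOrientation G o =
  (∀ u v → o u v ≡ true → Adj G u v)
  × (∀ u v → Adj G u v → o u v ≡ true ⊎ o v u ≡ true)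
  × (∀ u v → o u v ≡ true → o v u ≡ false)

IsMINI : (G : Graph) (q : ℕ) → (Fin (n G) → Fin (n G) → Bool) →
         (Fin (n G) → Fin q) → Set
IsMINI G q o f =
  IsOrientation G o × IsColouring G q f
  × (∀ v u w → o u v ≡ true → o v w ≡ true → f w ≢ f u)
  × (∀ v w₁ w₂ → o v w₁ ≡ true → o v w₂ ≡ true → f w₁ ≡ f w₂ → w₁ ≡ w₂)
  × (∀ v u₁ u₂ → o u₁ v ≡ true → o u₂ v ≡ true → f u₁ ≡ f u₂)

HasMINI : Graph → ℕ → Set
HasMINI G q = Σ[ o ∈ (Fin (n G) → Fin (n G) → Bool) ]
              Σ[ f ∈ (Fin (n G) → Fin q) ] IsMINI G q o f

-- oriented line graph L(K_q): vertices are pairs (i , j) of elements of Z_q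
-- with i ≢ j; arc (i , j) → (j' , k) iff j ≡ j' and k ≢ i.
LVertex : (q : ℕ) → Fin q × Fin q → Set
LVertex q (i , j) = i ≢ j

LArc : {q : ℕ} → Fin q × Fin q → Fin q × Fin q → Set
LArc (i , j) (j' , k) = j ≡ j' × k ≢ i

IsOBH : (G : Graph) (q : ℕ) → (Fin (n G) → Fin (n G) → Bool) →
        (Fin (n G) → Fin q × Fin q) → Set
IsOBH G q o ψ =
  (∀ v → LVertex q (ψ v))
  × (∀ v w → o v w ≡ true → LArc (ψ v) (ψ w))
  × (∀ v w₁ w₂ → o v w₁ ≡ true → o v w₂ ≡ true → ψ w₁ ≡ ψ w₂ → w₁ ≡ w₂)
  × (∀ v y → LVertex q y → LArc (ψ v) y → ∃[ w ] (o v w ≡ true × ψ w ≡ y))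

HasOBHOrientation : Graph → ℕ → Set
HasOBHOrientation G q =
  Σ[ o ∈ (Fin (n G) → Fin (n G) → Bool) ]
    IsOrientation G o × Σ[ ψ ∈ (Fin (n G) → Fin q × Fin q) ] IsOBH G q o ψ

HasK1pColouring : Graph → ℕ → ℕ → Set
HasK1pColouring G k p =
  Σ[ f ∈ (Fin (n G) → Fin k) ]
    IsColouring G k f × AllBicolComps G f (λ S → InducedIsoStar G S p)

-- A star colouring is turned into an orientation by pointing every edge from a leaf to
-- the centre of its bicoloured star (edges forming a whole bicoloured component are
-- oriented by vertex index); this satisfies conditions (i) and (ii) of a MINI-orientation.
-- Conversely (i) and (ii) already carry all the information in a 2p-regular graph with
-- p + 2 colours: the out-neighbours of v have distinct colours avoiding f v and the colour
-- of an in-neighbour, so every out-degree is at most p, and as out- and in-degrees have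
-- equal sums and add up to 2p, all of them equal p. So the out-neighbours of v take every
-- colour except f v and that of an in-neighbour. This forces (iii), yields the OBH
-- v ↦ (colour of the in-neighbours of v , f v) to L(K_{p+2}), and shows that every
-- bicoloured component is a vertex together with its p in-neighbours, i.e. a K_{1,p}.

module Submission where

open import Data.Bool using (Bool; true; false; if_then_else_)
import Data.Bool.Properties as Bool
open import Data.Empty using (⊥)
open import Data.Fin using (Fin; zero; suc; punchOut; _<_)
open import Data.Fin.Properties using (any?; <-cmp; <-asym; punchOut-injective; suc-injective; injective⇒≤)
  renaming (_≟_ to _≟ᶠ_; _<?_ to _<ᶠ?_)
open import Data.List using (map; allFin; tabulate)
open import Data.List.Properties using (map-tabulate)
import Data.Nat.ListAction as List
open import Data.Nat using (ℕ; zero; suc; _+_; _*_; _≤_; z≤n; s≤s)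
  renaming (_<_ to _<ⁿ_)
open import Data.Nat.Properties
  using (module ≤-Reasoning; +-0-commutativeMonoid; ≤-antisym; ≤-trans; ≤-reflexive;
         +-mono-≤; +-monoˡ-≤; +-mono-<-≤; +-cancelˡ-≡; +-cancelˡ-≤; +-identityʳ; +-comm;
         <⇒≢; <-irrefl; ≤⇒≯; m≤n⇒m<n∨m≡n; m<1+n⇒m≤n)
open import Data.Product using (∃-syntax; _×_; _,_; proj₁; proj₂; map₂)
import Data.Product as ×
open import Data.Sum using (_⊎_; inj₁; inj₂; [_,_]′)
import Data.Sum as ⊎
open import Function using (_∘_; id; _⇔_; mk⇔)
open import Function.Definitions using (Injective)
open import Relation.Binary using (Decidable; tri<; tri≈; tri>)
open import Relation.Binary.PropositionalEquality
  using (module ≡-Reasoning; _≡_; _≢_; _≗_; refl; sym; trans; cong; cong₂; subst)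
open import Relation.Nullary using (Dec; yes; no; ¬_; does; contradiction)
open import Relation.Nullary.Decidable using (_×-dec_; _⊎-dec_; ¬?; dec-true; dec-false)

open import Defs
open import Algebra.Properties.CommutativeMonoid.Sum +-0-commutativeMonoid
  using (sum; ∑-distrib-+; ∑-comm; sum-cong-≗; sum-replicate-zero)

indicator : Bool → ℕ
indicator b = if b then 1 else 0

count : ∀ {n} → (Fin n → Bool) → ℕ
count P = sum (indicator ∘ P)

listSum-allFin : ∀ {n} (g : Fin n → ℕ) → List.sum (map g (allFin n)) ≡ sum g
listSum-allFin g = trans (cong List.sum (map-tabulate id g)) (listSum-tabulate g)
  where
  listSum-tabulate : ∀ {n} (g : Fin n → ℕ) → List.sum (tabulate g) ≡ sum g
  listSum-tabulate {zero}  g = refl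
  listSum-tabulate {suc n} g = cong (g zero +_) (listSum-tabulate (g ∘ suc))

count-≡0 : ∀ {n} {P : Fin n → Bool} → (∀ x → P x ≡ false) → count P ≡ 0
count-≡0 {n} P≡false = trans (sum-cong-≗ (cong indicator ∘ P≡false)) (sum-replicate-zero n)

+-≡-≤⇒≡ : ∀ {a b c d} → a ≤ b → c ≤ d → a + c ≡ b + d → a ≡ b × c ≡ d
+-≡-≤⇒≡ {a} {b} {c} {d} a≤b c≤d a+c≡b+d with m≤n⇒m<n∨m≡n a≤b
... | inj₁ a<b  = contradiction a+c≡b+d (<⇒≢ (+-mono-<-≤ a<b c≤d))
... | inj₂ refl = refl , +-cancelˡ-≡ a c d a+c≡b+d

∑-mono-≤ : ∀ {n} {f g : Fin n → ℕ} → (∀ i → f i ≤ g i) → sum f ≤ sum g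
∑-mono-≤ {zero}  f≤g = z≤n
∑-mono-≤ {suc n} f≤g = +-mono-≤ (f≤g zero) (∑-mono-≤ (f≤g ∘ suc))

∑-≡-≤⇒≗ : ∀ {n} {f g : Fin n → ℕ} → (∀ i → f i ≤ g i) → sum f ≡ sum g → f ≗ g
∑-≡-≤⇒≗ {zero}  _   _      ()
∑-≡-≤⇒≗ {suc n} {f} {g} f≤g ∑f≡∑g = λ where
    zero    → proj₁ head-and-tail
    (suc i) → ∑-≡-≤⇒≗ (f≤g ∘ suc) (proj₂ head-and-tail) i
  where
  head-and-tail : f zero ≡ g zero × sum (f ∘ suc) ≡ sum (g ∘ suc)
  head-and-tail = +-≡-≤⇒≡ (f≤g zero) (∑-mono-≤ (f≤g ∘ suc)) ∑f≡∑g

record Enumeration {n} (P : Fin n → Bool) (m : ℕ) : Set where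
  field
    elem            : Fin m → Fin n
    elem-injective  : Injective _≡_ _≡_ elem
    elem-satisfies  : ∀ i → P (elem i) ≡ true
    elem-surjective : ∀ x → P x ≡ true → ∃[ i ] elem i ≡ x

module _ {n m} {P : Fin (suc n) → Bool} (E : Enumeration (P ∘ suc) m) where
  open Enumeration E

  skipZero : P zero ≡ false → Enumeration P m
  skipZero P0≡false = record
    { elem            = suc ∘ elem
    ; elem-injective  = elem-injective ∘ suc-injective
    ; elem-satisfies  = elem-satisfies
    ; elem-surjective = surjective
    }
    where
    surjective : ∀ x → P x ≡ true → ∃[ i ] suc (elem i) ≡ x
    surjective zero    P0≡true = contradiction (trans (sym P0≡false) P0≡true) λ ()
    surjective (suc x) Px      = map₂ (cong suc) (elem-surjective x Px)

  includeZero : P zero ≡ true → Enumeration P (suc m)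
  includeZero P0≡true = record
    { elem            = elem′
    ; elem-injective  = injective
    ; elem-satisfies  = satisfies
    ; elem-surjective = surjective
    }
    where
    elem′ : Fin (suc m) → Fin (suc n)
    elem′ zero    = zero
    elem′ (suc i) = suc (elem i)
    injective : Injective _≡_ _≡_ elem′
    injective {zero}  {zero}  _  = refl
    injective {zero}  {suc _} ()
    injective {suc _} {zero}  ()
    injective {suc i} {suc j} e = cong suc (elem-injective (suc-injective e))
    satisfies : ∀ i → P (elem′ i) ≡ true
    satisfies zero    = P0≡true
    satisfies (suc i) = elem-satisfies i
    surjective : ∀ x → P x ≡ true → ∃[ i ] elem′ i ≡ x
    surjective zero    _  = zero , refl
    surjective (suc x) Px = ×.map suc (cong suc) (elem-surjective x Px)

enumerate : ∀ {n} (P : Fin n → Bool) → Enumeration P (count P)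
enumerate {zero}  P = record
  { elem = λ () ; elem-injective = λ { {()} } ; elem-satisfies = λ () ; elem-surjective = λ () }
enumerate {suc n} P = enumerateFrom (P zero) refl
  where
  enumerateFrom : ∀ b → P zero ≡ b → Enumeration P (indicator b + count (P ∘ suc))
  enumerateFrom true  = includeZero (enumerate (P ∘ suc))
  enumerateFrom false = skipZero (enumerate (P ∘ suc))

module _ {m n} {g : Fin m → Fin (suc n)} {c} (g≢c : ∀ i → g i ≢ c) where

  squeeze : Fin m → Fin n
  squeeze i = punchOut (g≢c i ∘ sym)

  squeeze-injective : Injective _≡_ _≡_ g → Injective _≡_ _≡_ squeeze
  squeeze-injective g-inj {i} {j} e = g-inj (punchOut-injective (g≢c i ∘ sym) (g≢c j ∘ sym) e)

  squeeze-≢ : ∀ {d} (c≢d : c ≢ d) → (∀ i → g i ≢ d) → ∀ i → squeeze i ≢ punchOut c≢d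
  squeeze-≢ c≢d g≢d i e = g≢d i (punchOut-injective (g≢c i ∘ sym) c≢d e)

injective-missing⇒< : ∀ {m n} {g : Fin m → Fin n} {c} →
  Injective _≡_ _≡_ g → (∀ i → g i ≢ c) → m <ⁿ n
injective-missing⇒< {n = suc n} g-inj g≢c = s≤s (injective⇒≤ (squeeze-injective g≢c g-inj))

injective-missing₂⇒< : ∀ {m n} {g : Fin m → Fin (suc n)} {c d} →
  Injective _≡_ _≡_ g → c ≢ d → (∀ i → g i ≢ c) → (∀ i → g i ≢ d) → m <ⁿ n
injective-missing₂⇒< g-inj c≢d g≢c g≢d =
  injective-missing⇒< (squeeze-injective g≢c g-inj) (squeeze-≢ g≢c c≢d g≢d)

injective-missing₃⇒< : ∀ {m n} {g : Fin m → Fin (suc (suc n))} {c d e} →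
  Injective _≡_ _≡_ g → c ≢ d → c ≢ e → d ≢ e →
  (∀ i → g i ≢ c) → (∀ i → g i ≢ d) → (∀ i → g i ≢ e) → m <ⁿ n
injective-missing₃⇒< g-inj c≢d c≢e d≢e g≢c g≢d g≢e =
  injective-missing₂⇒< (squeeze-injective g≢c g-inj) (d≢e ∘ punchOut-injective c≢d c≢e)
    (squeeze-≢ g≢c c≢d g≢d) (squeeze-≢ g≢c c≢e g≢e)

Adj-sym : ∀ {G u v} → Adj G u v → Adj G v u
Adj-sym {G} {u} {v} = trans (adj-sym G v u)

Adj⇒≢ : ∀ {G u v} → Adj G u v → u ≢ v
Adj⇒≢ {G} {u} uv refl = contradiction (trans (sym uv) (adj-irr G u)) λ ()

degree≡count : ∀ G v → degree G v ≡ count (adj G v)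
degree≡count G v = listSum-allFin (indicator ∘ adj G v)

outDegree : ∀ {m} → (Fin m → Fin m → Bool) → Fin m → ℕ
outDegree o v = count (o v)

inDegree : ∀ {m} → (Fin m → Fin m → Bool) → Fin m → ℕ
inDegree o v = count (λ u → o u v)

∑outDegree≡∑inDegree : ∀ {m} (o : Fin m → Fin m → Bool) → sum (outDegree o) ≡ sum (inDegree o)
∑outDegree≡∑inDegree o = ∑-comm (λ v w → indicator (o v w))

module _ {G : Graph} {o} (ori : IsOrientation G o) where
  private
    arc⇒Adj : ∀ u v → o u v ≡ true → Adj G u v
    arc⇒Adj = proj₁ ori
    Adj⇒arc : ∀ u v → Adj G u v → o u v ≡ true ⊎ o v u ≡ true
    Adj⇒arc = proj₁ (proj₂ ori)
    arc-asym : ∀ u v → o u v ≡ true → o v u ≡ false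
    arc-asym = proj₂ (proj₂ ori)

    NonAdj⇒noArc : ∀ {u v} → NonAdj G u v → o u v ≡ false
    NonAdj⇒noArc {u} {v} uv with o u v in arc
    ... | false = refl
    ... | true  = contradiction (trans (sym (arc⇒Adj u v arc)) uv) λ ()

  indicator-adj : ∀ u v → indicator (adj G u v) ≡ indicator (o u v) + indicator (o v u)
  indicator-adj u v with adj G u v in uv
  ... | false rewrite NonAdj⇒noArc uv | NonAdj⇒noArc (trans (adj-sym G v u) uv) = refl
  ... | true with Adj⇒arc u v uv
  ...   | inj₁ u→v rewrite u→v | arc-asym u v u→v = refl
  ...   | inj₂ v→u rewrite v→u | arc-asym v u v→u = refl

  outDegree+inDegree≡degree : ∀ v → outDegree o v + inDegree o v ≡ degree G v
  outDegree+inDegree≡degree v = begin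
    outDegree o v + inDegree o v
      ≡⟨ ∑-distrib-+ (indicator ∘ o v) (λ u → indicator (o u v)) ⟨
    sum (λ w → indicator (o v w) + indicator (o w v))
      ≡⟨ sum-cong-≗ (sym ∘ indicator-adj v) ⟩
    count (adj G v)
      ≡⟨ degree≡count G v ⟨
    degree G v
      ∎
    where open ≡-Reasoning

module Balanced {p G} (reg : Regular (2 * p) G) {o} (ori : IsOrientation G o)
         (outDegree≤p : ∀ v → outDegree o v ≤ p) where

  p≤inDegree : ∀ v → p ≤ inDegree o v
  p≤inDegree v = +-cancelˡ-≤ p p (inDegree o v) (begin
    p + p                        ≡⟨ cong (p +_) (+-identityʳ p) ⟨
    2 * p                        ≡⟨ trans (outDegree+inDegree≡degree {G} {o} ori v) (reg v) ⟨
    outDegree o v + inDegree o v ≤⟨ +-monoˡ-≤ (inDegree o v) (outDegree≤p v) ⟩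
    p + inDegree o v             ∎)
    where open ≤-Reasoning

  outDegree≡inDegree : outDegree o ≗ inDegree o
  outDegree≡inDegree =
    ∑-≡-≤⇒≗ (λ v → ≤-trans (outDegree≤p v) (p≤inDegree v)) (∑outDegree≡∑inDegree o)

  outDegree≡p : ∀ v → outDegree o v ≡ p
  outDegree≡p v = ≤-antisym (outDegree≤p v) (subst (p ≤_) (sym (outDegree≡inDegree v)) (p≤inDegree v))

  inDegree≡p : ∀ v → inDegree o v ≡ p
  inDegree≡p v = trans (sym (outDegree≡inDegree v)) (outDegree≡p v)

OneOf : ∀ {A : Set} → A → A → A → Set
OneOf a b c = c ≡ a ⊎ c ≡ b

OneOf-other : ∀ {A : Set} {a b x : A} → a ≢ b → OneOf a b x → ∃[ y ] (OneOf a b y × y ≢ x)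
OneOf-other {a = a} {b} a≢b (inj₁ refl) = b , inj₂ refl , a≢b ∘ sym
OneOf-other {a = a} {b} a≢b (inj₂ refl) = a , inj₁ refl , a≢b

OneOf-≢⇒≡ : ∀ {A : Set} {a b x y c : A} →
  OneOf a b x → OneOf a b y → x ≢ y → OneOf a b c → c ≢ x → c ≡ y
OneOf-≢⇒≡ (inj₁ refl) (inj₁ refl) x≢y _           _   = contradiction refl x≢y
OneOf-≢⇒≡ (inj₂ refl) (inj₂ refl) x≢y _           _   = contradiction refl x≢y
OneOf-≢⇒≡ (inj₁ refl) (inj₂ refl) _   (inj₁ refl) c≢x = contradiction refl c≢x
OneOf-≢⇒≡ (inj₁ refl) (inj₂ refl) _   (inj₂ refl) _   = refl
OneOf-≢⇒≡ (inj₂ refl) (inj₁ refl) _   (inj₁ refl) _   = refl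
OneOf-≢⇒≡ (inj₂ refl) (inj₁ refl) _   (inj₂ refl) c≢x = contradiction refl c≢x

InOutDisjoint : (G : Graph) {q : ℕ} → (Fin (n G) → Fin (n G) → Bool) → (Fin (n G) → Fin q) → Set
InOutDisjoint G o f = ∀ v u w → o u v ≡ true → o v w ≡ true → f w ≢ f u

OutRainbow : (G : Graph) {q : ℕ} → (Fin (n G) → Fin (n G) → Bool) → (Fin (n G) → Fin q) → Set
OutRainbow G o f = ∀ v w₁ w₂ → o v w₁ ≡ true → o v w₂ ≡ true → f w₁ ≡ f w₂ → w₁ ≡ w₂

InMonochromatic : (G : Graph) {q : ℕ} → (Fin (n G) → Fin (n G) → Bool) → (Fin (n G) → Fin q) → Set
InMonochromatic G o f = ∀ v u₁ u₂ → o u₁ v ≡ true → o u₂ v ≡ true → f u₁ ≡ f u₂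

-- Colours live in Fin (2 + p) = Fin (suc (suc p)), the shape on which punchOut works.
module PartialMINI {p} (2≤p : 2 ≤ p) {G} (reg : Regular (2 * p) G)
         {o} {f : Fin (n G) → Fin (2 + p)} (ori : IsOrientation G o) (col : IsColouring G (2 + p) f)
         (disjoint : InOutDisjoint G o f) (rainbow : OutRainbow G o f) where

  private
    arc⇒Adj : ∀ {u v} → o u v ≡ true → Adj G u v
    arc⇒Adj = proj₁ ori _ _

    module Out v = Enumeration (enumerate (o v))

  outColour : ∀ v → Fin (outDegree o v) → Fin (2 + p)
  outColour v = f ∘ Out.elem v

  outColour-injective : ∀ v → Injective _≡_ _≡_ (outColour v)
  outColour-injective v = Out.elem-injective v ∘ rainbow v _ _ (Out.elem-satisfies v _) (Out.elem-satisfies v _)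

  outColour≢colour : ∀ v i → outColour v i ≢ f v
  outColour≢colour v i = col v (Out.elem v i) (arc⇒Adj (Out.elem-satisfies v i)) ∘ sym

  outColour≢inColour : ∀ {u v} → o u v ≡ true → ∀ i → outColour v i ≢ f u
  outColour≢inColour {u} {v} u→v i = disjoint v u (Out.elem v i) u→v (Out.elem-satisfies v i)

  inNeighbour : ∀ v → ∃[ u ] o u v ≡ true
  inNeighbour v with any? (λ u → o u v Bool.≟ true)
  ... | yes ∃u = ∃u
  ... | no  ∄u =
    contradiction (injective-missing⇒< (outColour-injective v) (outColour≢colour v)) (≤⇒≯ 2+p≤out)
    where
    open ≤-Reasoning
    2+p≤out : 2 + p ≤ outDegree o v
    2+p≤out = begin
      2 + p                        ≤⟨ +-mono-≤ 2≤p (≤-reflexive (sym (+-identityʳ p))) ⟩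
      2 * p                        ≡⟨ trans (outDegree+inDegree≡degree {G} {o} ori v) (reg v) ⟨
      outDegree o v + inDegree o v ≡⟨ cong (outDegree o v +_) (count-≡0 (λ u → Bool.¬-not (∄u ∘ (u ,_)))) ⟩
      outDegree o v + 0            ≡⟨ +-identityʳ (outDegree o v) ⟩
      outDegree o v                ∎

  outDegree≤p : ∀ v → outDegree o v ≤ p
  outDegree≤p v with inNeighbour v
  ... | u , u→v = m<1+n⇒m≤n (injective-missing₂⇒< (outColour-injective v) (col u v (arc⇒Adj u→v) ∘ sym)
                    (outColour≢colour v) (outColour≢inColour u→v))

  open Balanced {p} {G} reg {o} ori outDegree≤p using (outDegree≡p; inDegree≡p)

  outColour-surjective : ∀ {u v} → o u v ≡ true →
    ∀ c → c ≢ f v → c ≢ f u → ∃[ w ] (o v w ≡ true × f w ≡ c)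
  outColour-surjective {u} {v} u→v c c≢fv c≢fu with any? (λ w → (o v w Bool.≟ true) ×-dec (f w ≟ᶠ c))
  ... | yes ∃w = ∃w
  ... | no  ∄w = contradiction out<p (<-irrefl (outDegree≡p v))
    where
    out<p : outDegree o v <ⁿ p
    out<p = injective-missing₃⇒< (outColour-injective v)
      (col u v (arc⇒Adj u→v) ∘ sym) (c≢fv ∘ sym) (c≢fu ∘ sym)
      (outColour≢colour v) (outColour≢inColour u→v) (λ i e → ∄w (Out.elem v i , Out.elem-satisfies v i , e))

  inMonochromatic : InMonochromatic G o f
  inMonochromatic v u₁ u₂ u₁→v u₂→v with f u₁ ≟ᶠ f u₂
  ... | yes fu₁≡fu₂ = fu₁≡fu₂
  ... | no  fu₁≢fu₂
    with outColour-surjective u₁→v (f u₂) (col u₂ v (arc⇒Adj u₂→v)) (fu₁≢fu₂ ∘ sym)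
  ...   | w , v→w , fw≡fu₂ = contradiction fw≡fu₂ (disjoint v u₂ w u₂→v v→w)

  inColour : Fin (n G) → Fin (2 + p)
  inColour v = f (proj₁ (inNeighbour v))

  inNeighbour-colour : ∀ {u v} → o u v ≡ true → f u ≡ inColour v
  inNeighbour-colour {u} {v} u→v = inMonochromatic v u _ u→v (proj₂ (inNeighbour v))

  inColour≢colour : ∀ v → inColour v ≢ f v
  inColour≢colour v = col _ v (arc⇒Adj (proj₂ (inNeighbour v)))

  isOBH : IsOBH G (2 + p) o (λ v → inColour v , f v)
  isOBH = inColour≢colour , arc , injective , surjective
    where
    arc : ∀ v w → o v w ≡ true → LArc (inColour v , f v) (inColour w , f w)
    arc v w v→w = inNeighbour-colour v→w , disjoint v _ w (proj₂ (inNeighbour v)) v→w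
    injective : ∀ v w₁ w₂ → o v w₁ ≡ true → o v w₂ ≡ true →
                (inColour w₁ , f w₁) ≡ (inColour w₂ , f w₂) → w₁ ≡ w₂
    injective v w₁ w₂ v→w₁ v→w₂ = rainbow v w₁ w₂ v→w₁ v→w₂ ∘ cong proj₂
    surjective : ∀ v y → LVertex (2 + p) y → LArc (inColour v , f v) y →
                 ∃[ w ] (o v w ≡ true × (inColour w , f w) ≡ y)
    surjective v (j , k) j≢k (fv≡j , k≢inColour)
      with outColour-surjective (proj₂ (inNeighbour v)) k
             (λ k≡fv → j≢k (trans (sym fv≡j) (sym k≡fv))) k≢inColour
    ... | w , v→w , fw≡k = w , v→w , cong₂ _,_ (trans (sym (inNeighbour-colour v→w)) fv≡j) fw≡k

  module _ {a b : Fin (2 + p)} (a≢b : a ≢ b) where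

    -- the centre is v itself, or else the out-neighbour of v with the colour of {a , b} other than f v
    centre : ∀ {v} → OneOf a b (f v) →
      ∃[ z ] ((v ≡ z ⊎ o v z ≡ true) × OneOf a b (f z) × OneOf a b (inColour z))
    centre {v} Cv with OneOf-other a≢b Cv
    ... | y , Cy , y≢fv with inColour v ≟ᶠ y
    ...   | yes inColour≡y = v , inj₁ refl , Cv , subst (OneOf a b) (sym inColour≡y) Cy
    ...   | no  inColour≢y with outColour-surjective (proj₂ (inNeighbour v)) y y≢fv (inColour≢y ∘ sym)
    ...     | w , v→w , fw≡y =
      w , inj₂ v→w , subst (OneOf a b) (sym fw≡y) Cy , subst (OneOf a b) (inNeighbour-colour v→w) Cv

    module _ {v z} (Cv : OneOf a b (f v)) (v≡z⊎v→z : v ≡ z ⊎ o v z ≡ true)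
             (Cz : OneOf a b (f z)) (Ciz : OneOf a b (inColour z)) where

      centre-neighbour-colour : ∀ {w} → Adj G z w → OneOf a b (f w) → f w ≡ inColour z
      centre-neighbour-colour z~w Cw = OneOf-≢⇒≡ Cz Ciz (inColour≢colour z ∘ sym) Cw (col _ _ z~w ∘ sym)

      leaf-neighbour-colour : ∀ {u w} → o u z ≡ true → Adj G u w → OneOf a b (f w) → f w ≡ f z
      leaf-neighbour-colour u→z u~w Cw =
        OneOf-≢⇒≡ Ciz Cz (inColour≢colour z) Cw (λ e → col _ _ u~w (trans (inNeighbour-colour u→z) (sym e)))

      component⊆star : ∀ {w} → Reach G f a b v w → w ≡ z ⊎ o w z ≡ true
      component⊆star (here _) = v≡z⊎v→z
      component⊆star (step {u} {w} R u~w Cw) with component⊆star R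
      ... | inj₁ refl with proj₁ (proj₂ ori) z w u~w
      ...   | inj₁ z→w =
        contradiction (centre-neighbour-colour u~w Cw) (disjoint z _ w (proj₂ (inNeighbour z)) z→w)
      ...   | inj₂ w→z = inj₂ w→z
      component⊆star (step {u} {w} R u~w Cw) | inj₂ u→z with proj₁ (proj₂ ori) u w u~w
      ... | inj₁ u→w = inj₁ (sym (rainbow u z w u→z u→w (sym (leaf-neighbour-colour u→z u~w Cw))))
      ... | inj₂ w→u = contradiction (sym (leaf-neighbour-colour u→z u~w Cw)) (disjoint u w z w→u u→z)

      centre-in-component : Reach G f a b v z
      centre-in-component =
        [ (λ { refl → here Cv }) , (λ v→z → step (here Cv) (arc⇒Adj v→z) Cz) ]′ v≡z⊎v→z

      component-star : InducedIsoStar G (Reach G f a b v) p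
      component-star = z , elem , (λ _ _ → elem-injective) , z≢leaf , covered , centre-in-component ,
                       leaf-in-component , centre~leaf , leaves-nonadjacent
        where
        open Enumeration (subst (Enumeration (λ u → o u z)) (inDegree≡p z) (enumerate _))
        centre~leaf : ∀ i → Adj G z (elem i)
        centre~leaf i = Adj-sym {G} (arc⇒Adj (elem-satisfies i))
        z≢leaf : ∀ i → z ≢ elem i
        z≢leaf i = Adj⇒≢ {G} (centre~leaf i)
        covered : ∀ w → Reach G f a b v w → w ≡ z ⊎ ∃[ i ] elem i ≡ w
        covered w R with component⊆star R
        ... | inj₁ w≡z = inj₁ w≡z
        ... | inj₂ w→z = inj₂ (elem-surjective w w→z)
        leaf-in-component : ∀ i → Reach G f a b v (elem i)
        leaf-in-component i = step centre-in-component (centre~leaf i)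
          (subst (OneOf a b) (sym (inNeighbour-colour (elem-satisfies i))) Ciz)
        leaves-nonadjacent : ∀ i j → NonAdj G (elem i) (elem j)
        leaves-nonadjacent i j = Bool.¬-not λ ℓi~ℓj → col _ _ ℓi~ℓj
          (trans (inNeighbour-colour (elem-satisfies i)) (sym (inNeighbour-colour (elem-satisfies j))))

  bicolouredComponents-K1p : AllBicolComps G f (λ S → InducedIsoStar G S p)
  bicolouredComponents-K1p a b a≢b v Cv with centre a≢b Cv
  ... | z , v≡z⊎v→z , Cz , Ciz = component-star a≢b Cv v≡z⊎v→z Cz Ciz

OBH⇒MINI : ∀ {G q} → HasOBHOrientation G q → HasMINI G q
OBH⇒MINI {G} {q} (o , ori , ψ , ψ-vertex , ψ-arc , ψ-injective , _) =
  o , proj₂ ∘ ψ , ori , proper , disjoint , rainbow , monochromatic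
  where
  proper : IsColouring G q (proj₂ ∘ ψ)
  proper u v u~v e with proj₁ (proj₂ ori) u v u~v
  ... | inj₁ u→v = ψ-vertex v (trans (sym (proj₁ (ψ-arc u v u→v))) e)
  ... | inj₂ v→u = ψ-vertex u (trans (sym (proj₁ (ψ-arc v u v→u))) (sym e))
  disjoint : InOutDisjoint G o (proj₂ ∘ ψ)
  disjoint v u w u→v v→w e = proj₂ (ψ-arc v w v→w) (trans e (proj₁ (ψ-arc u v u→v)))
  rainbow : OutRainbow G o (proj₂ ∘ ψ)
  rainbow v w₁ w₂ v→w₁ v→w₂ e =
    ψ-injective v w₁ w₂ v→w₁ v→w₂
      (cong₂ _,_ (trans (sym (proj₁ (ψ-arc v w₁ v→w₁))) (proj₁ (ψ-arc v w₂ v→w₂))) e)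
  monochromatic : InMonochromatic G o (proj₂ ∘ ψ)
  monochromatic v u₁ u₂ u₁→v u₂→v = trans (proj₁ (ψ-arc u₁ v u₁→v)) (sym (proj₁ (ψ-arc u₂ v u₂→v)))

K1p⇒star : ∀ {G k p} → HasK1pColouring G k p → HasStarColouring G k
K1p⇒star {p = p} (f , col , stars) = f , col , λ a b a≢b v Cv → p , stars a b a≢b v Cv

fromDoes : ∀ {A : Set} (a? : Dec A) → does a? ≡ true → A
fromDoes (yes a) _ = a

decidableOrientation : ∀ {G} {Arc : Fin (n G) → Fin (n G) → Set} (Arc? : Decidable Arc) →
  (∀ {u v} → Arc u v → Adj G u v) → (∀ {u v} → Adj G u v → Arc u v ⊎ Arc v u) →
  (∀ {u v} → Arc u v → ¬ Arc v u) → IsOrientation G (λ u v → does (Arc? u v))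
decidableOrientation Arc? arc⇒Adj total asym =
  (λ u v → arc⇒Adj ∘ fromDoes (Arc? u v)) ,
  (λ u v u~v → ⊎.map (dec-true (Arc? u v)) (dec-true (Arc? v u)) (total u~v)) ,
  (λ u v → dec-false (Arc? v u) ∘ asym ∘ fromDoes (Arc? u v))

star-edge-at-centre : ∀ {G S q} (star : InducedIsoStar G S q) {x y} → S x → S y → Adj G x y →
  x ≡ proj₁ star ⊎ y ≡ proj₁ star
star-edge-at-centre (c , ℓ , _ , _ , covered , _ , _ , _ , leaves-nonadjacent) {x} {y} Sx Sy x~y
  with covered x Sx | covered y Sy
... | inj₁ x≡c        | _               = inj₁ x≡c
... | inj₂ _          | inj₁ y≡c        = inj₂ y≡c
... | inj₂ (i , refl) | inj₂ (j , refl) = contradiction (trans (sym x~y) (leaves-nonadjacent i j)) λ ()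

module StarOrientation {G k} {f : Fin (n G) → Fin k}
         (col : IsColouring G k f) (stars : AllBicolComps G f (IsStar G)) where

  no-bicoloured-P₄ : ∀ {x y z w} → Adj G x y → Adj G y z → Adj G z w →
    f x ≡ f z → f y ≡ f w → x ≢ z → y ≢ w → ⊥
  no-bicoloured-P₄ {x} {y} {z} {w} x~y y~z z~w fx≡fz fy≡fw x≢z y≢w =
    centre-on-path (edge-at-centre Sx Sy x~y) (edge-at-centre Sy Sz y~z) (edge-at-centre Sz Sw z~w)
    where
    S : Fin (n G) → Set
    S = Reach G f (f x) (f y) x
    star : IsStar G S
    star = stars (f x) (f y) (col x y x~y) x (inj₁ refl)
    c : Fin (n G)
    c = proj₁ (proj₂ star)
    edge-at-centre : ∀ {s t} → S s → S t → Adj G s t → s ≡ c ⊎ t ≡ c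
    edge-at-centre = star-edge-at-centre {G} {S} (proj₂ star)
    Sx : S x
    Sx = here (inj₁ refl)
    Sy : S y
    Sy = step Sx x~y (inj₂ refl)
    Sz : S z
    Sz = step Sy y~z (inj₁ (sym fx≡fz))
    Sw : S w
    Sw = step Sz z~w (inj₂ (sym fy≡fw))
    centre-on-path : x ≡ c ⊎ y ≡ c → y ≡ c ⊎ z ≡ c → z ≡ c ⊎ w ≡ c → ⊥
    centre-on-path (inj₁ x≡c) (inj₁ y≡c) _          = Adj⇒≢ {G} x~y (trans x≡c (sym y≡c))
    centre-on-path (inj₁ x≡c) (inj₂ z≡c) _          = x≢z (trans x≡c (sym z≡c))
    centre-on-path (inj₂ y≡c) _          (inj₁ z≡c) = Adj⇒≢ {G} y~z (trans y≡c (sym z≡c))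
    centre-on-path (inj₂ y≡c) _          (inj₂ w≡c) = y≢w (trans y≡c (sym w≡c))

  -- RepeatsColour v u: the bicoloured star containing the edge uv has centre v and at least two leaves.
  RepeatsColour : Fin (n G) → Fin (n G) → Set
  RepeatsColour u v = ∃[ w ] (Adj G u w × f w ≡ f v × w ≢ v)

  RepeatsColour? : Decidable RepeatsColour
  RepeatsColour? u v = any? (λ w → (adj G u w Bool.≟ true) ×-dec (f w ≟ᶠ f v) ×-dec ¬? (w ≟ᶠ v))

  ¬RepeatsColour-both : ∀ {u v} → Adj G u v → RepeatsColour u v → RepeatsColour v u → ⊥
  ¬RepeatsColour-both u~v (v′ , u~v′ , fv′≡fv , v′≢v) (u′ , v~u′ , fu′≡fu , u′≢u) =
    no-bicoloured-P₄ (Adj-sym {G} v~u′) (Adj-sym {G} u~v) u~v′ fu′≡fu (sym fv′≡fv) u′≢u (v′≢v ∘ sym)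

  Arc : Fin (n G) → Fin (n G) → Set
  Arc u v = Adj G u v × ¬ RepeatsColour u v × (RepeatsColour v u ⊎ u < v)

  Arc? : Decidable Arc
  Arc? u v = (adj G u v Bool.≟ true) ×-dec ¬? (RepeatsColour? u v) ×-dec (RepeatsColour? v u ⊎-dec (u <ᶠ? v))

  Arc-asym : ∀ {u v} → Arc u v → ¬ Arc v u
  Arc-asym (_ , _    , inj₁ vRu) (_ , ¬vRu , _        ) = ¬vRu vRu
  Arc-asym (_ , ¬uRv , _        ) (_ , _    , inj₁ uRv) = ¬uRv uRv
  Arc-asym (_ , _    , inj₂ u<v) (_ , _    , inj₂ v<u) = <-asym u<v v<u

  Arc-total : ∀ {u v} → Adj G u v → Arc u v ⊎ Arc v u
  Arc-total {u} {v} u~v with RepeatsColour? u v | RepeatsColour? v u | <-cmp u v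
  ... | yes uRv | _       | _           = inj₂ (Adj-sym {G} u~v , ¬RepeatsColour-both u~v uRv , inj₁ uRv)
  ... | no ¬uRv | yes vRu | _           = inj₁ (u~v , ¬uRv , inj₁ vRu)
  ... | no ¬uRv | no _    | tri< u<v _ _ = inj₁ (u~v , ¬uRv , inj₂ u<v)
  ... | no _    | no _    | tri≈ _ u≡v _ = contradiction u≡v (Adj⇒≢ {G} u~v)
  ... | no _    | no ¬vRu | tri> _ _ v<u = inj₂ (Adj-sym {G} u~v , ¬vRu , inj₂ v<u)

  orientation : Fin (n G) → Fin (n G) → Bool
  orientation u v = does (Arc? u v)

  private
    arc : ∀ {u v} → orientation u v ≡ true → Arc u v
    arc = fromDoes (Arc? _ _)

  isOrientation : IsOrientation G orientation
  isOrientation = decidableOrientation {G} Arc? proj₁ Arc-total Arc-asym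

  inOutDisjoint : InOutDisjoint G orientation f
  inOutDisjoint v u w u→v v→w fw≡fu with u ≟ᶠ w
  ... | yes refl = Arc-asym (arc u→v) (arc v→w)
  ... | no  u≢w  = proj₁ (proj₂ (arc v→w)) (u , Adj-sym {G} (proj₁ (arc u→v)) , sym fw≡fu , u≢w)

  outRainbow : OutRainbow G orientation f
  outRainbow v w₁ w₂ v→w₁ v→w₂ fw₁≡fw₂ with w₁ ≟ᶠ w₂
  ... | yes w₁≡w₂ = w₁≡w₂
  ... | no  w₁≢w₂ =
    contradiction (w₂ , proj₁ (arc v→w₂) , sym fw₁≡fw₂ , w₁≢w₂ ∘ sym) (proj₁ (proj₂ (arc v→w₁)))

module Equivalence {p} (2≤p : 2 ≤ p) {G} (reg : Regular (2 * p) G) where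
  open PartialMINI 2≤p {G} reg

  star⇒MINI : HasStarColouring G (2 + p) → HasMINI G (2 + p)
  star⇒MINI (f , col , stars) =
    orientation , f , isOrientation , col , inOutDisjoint , outRainbow ,
    inMonochromatic {orientation} {f} isOrientation col inOutDisjoint outRainbow
    where open StarOrientation col stars

  MINI⇒OBH : HasMINI G (2 + p) → HasOBHOrientation G (2 + p)
  MINI⇒OBH (o , f , ori , col , disjoint , rainbow , _) =
    o , ori , _ , isOBH {o} {f} ori col disjoint rainbow

  MINI⇒K1p : HasMINI G (2 + p) → HasK1pColouring G (2 + p) p
  MINI⇒K1p (o , f , ori , col , disjoint , rainbow , _) =
    f , col , bicolouredComponents-K1p {o} {f} ori col disjoint rainbow

  MINI⇒star : HasMINI G (2 + p) → HasStarColouring G (2 + p)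
  MINI⇒star = K1p⇒star ∘ MINI⇒K1p

theorem7 : (p : ℕ) → 2 ≤ p → (G : Graph) → Regular (2 * p) G →
    (HasStarColouring G (p + 2) ⇔ HasMINI G (p + 2))
    × (HasStarColouring G (p + 2) ⇔ HasOBHOrientation G (p + 2))
    × (HasStarColouring G (p + 2) ⇔ HasK1pColouring G (p + 2) p)
theorem7 p 2≤p G reg rewrite +-comm p 2 =
  mk⇔ star⇒MINI MINI⇒star ,
  mk⇔ (MINI⇒OBH ∘ star⇒MINI) (MINI⇒star ∘ OBH⇒MINI {G}) ,
  mk⇔ (MINI⇒K1p ∘ star⇒MINI) K1p⇒star
  where open Equivalence 2≤p reg
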